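{- Let $G$ be a graph (a subgraph of an $n$-node input graph) in which every node $v$ has a palette of size $p(v)$ and degree $d(v)$ in $G$, and let $\ell$ be a sufficiently large number such that $\ell^{0.1}$ is an integer. Let $h_1$ map the nodes of $G$ to bins $\{1,\dots,\ell^{0.1}\}$ and $h_2$ map colors to bins $\{1,\dots,\ell^{0.1}-1\}$ (arbitrary functions). Assume that for all nodes $v$ of $G$: (i) $\ell<p(v)$, (ii) $d(v)\le \ell+\ell^{0.7}$, (iii) $d(v)<p(v)$. Let $\ell'=\ell^{0.9}-\ell^{0.6}$. Then for every good node $v$: (i) $\ell'<p'(v)$, (ii) $d'(v)\le \ell'+\ell'^{0.7}$, and (iii) $d'(v)<p'(v)$.
   Context: $d'(v)$ is the number of neighbors $u$ of $v$ in $G$ with $h_1(u)=h_1(v)$. For a node $v$ with $h_1(v)\in\{1,\dots,\ell^{0.1}-1\}$, $p'(v)$ is the number of colors $\gamma$ in $v$'s palette with $h_2(\gamma)=h_1(v)$. For a node $v$ with $h_1(v)=\ell^{0.1}$, $p'(v)$ is the number of colors remaining in $v$'s palette after removing the colors assigned (one color each) to $v$'s neighbors lying in bins $1,\dots,\ell^{0.1}-1$. A node $v$ with $h_1(v)\in\{1,\dots,\ell^{0.1}-1\}$ is good if $|d'(v)-d(v)\ell^{ -0.1}|\le \ell^{0.6}$ and $p'(v)\ge p(v)\ell^{ -0.1}+\ell^{0.7}$; a node $v$ with $h_1(v)=\ell^{0.1}$ is good if $|d'(v)-d(v)\ell^{ -0.1}|\le\ell^{0.6}$. -}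

module Defs where

open import Data.Nat using (ℕ; zero; suc; _+_; _*_; _∸_; _^_; _≤_; _<_; _<ᵇ_; _≡ᵇ_)
open import Data.Bool using (Bool; true; false; if_then_else_; _∧_; _∨_; not)
open import Data.Fin using (Fin; zero; suc; _≟_)
open import Data.Product using (_×_)
open import Data.Sum using (_⊎_)
open import Relation.Nullary.Decidable using (⌊_⌋)
open import Relation.Binary.PropositionalEquality using (_≡_)

countF : ∀ {m} → (Fin m → Bool) → ℕ
countF {zero}  f = 0
countF {suc m} f = (if f zero then 1 else 0) + countF (λ i → f (suc i))

anyF : ∀ {m} → (Fin m → Bool) → Bool
anyF {zero}  f = false
anyF {suc m} f = f zero ∨ anyF (λ i → f (suc i))

record PaletteGraph : Set where
  field
    n       : ℕ
    C       : ℕ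
    adj     : Fin n → Fin n → Bool
    adj-sym : ∀ u v → adj u v ≡ adj v u
    adj-irr : ∀ v → adj v v ≡ false
    palette : Fin n → Fin C → Bool

open PaletteGraph public

deg : (G : PaletteGraph) → Fin (n G) → ℕ
deg G v = countF (adj G v)

pal : (G : PaletteGraph) → Fin (n G) → ℕ
pal G v = countF (palette G v)

deg' : (G : PaletteGraph) → (Fin (n G) → ℕ) → Fin (n G) → ℕ
deg' G h1 v = countF (λ u → adj G v u ∧ (h1 u ≡ᵇ h1 v))

-- p'(v), where k = ℓ^0.1 is the last bin.  Bins are 1..k for nodes (h1),
-- 1..k-1 for colours (h2).  col assigns one colour to each node (used only
-- for neighbours lying in bins 1..k-1).
pal' : (G : PaletteGraph) (k : ℕ) (h1 : Fin (n G) → ℕ) (h2 : Fin (C G) → ℕ)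
       (col : Fin (n G) → Fin (C G)) → Fin (n G) → ℕ
pal' G k h1 h2 col v =
  if h1 v <ᵇ k
  then countF (λ γ → palette G v γ ∧ (h2 γ ≡ᵇ h1 v))
  else countF (λ γ → palette G v γ ∧
         not (anyF (λ u → adj G v u ∧ (h1 u <ᵇ k) ∧ ⌊ col u ≟ γ ⌋)))

-- good node, with ℓ = k^10 (k = ℓ^0.1):
--   |d' - d ℓ^{-0.1}| ≤ ℓ^0.6   ⇔  |k d' - d| ≤ k^7
--   p' ≥ p ℓ^{-0.1} + ℓ^0.7      ⇔  k p' ≥ p + k^8
Good : (G : PaletteGraph) (k : ℕ) (h1 : Fin (n G) → ℕ) (h2 : Fin (C G) → ℕ)
       (col : Fin (n G) → Fin (C G)) → Fin (n G) → Set
Good G k h1 h2 col v =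
  (h1 v < k × dcond × pal G v + k ^ 8 ≤ k * pal' G k h1 h2 col v)
  ⊎ (h1 v ≡ k × dcond)
  where
  dcond : Set
  dcond = (k * deg' G h1 v ≤ deg G v + k ^ 7) × (deg G v ≤ k * deg' G h1 v + k ^ 7)

module Submission where

open import Defs
open import Data.Nat using (ℕ; _+_; _*_; _∸_; _^_; _≤_; _<_)
open import Data.Fin using (Fin)
open import Data.Product using (Σ; _×_)

open import Data.Nat using (zero; suc; _<ᵇ_; _≡ᵇ_; z≤n; s≤s; NonZero; >-nonZero)
open import Data.Nat.Properties hiding (_≟_)
open import Data.Nat.Tactic.RingSolver using (solve-∀)
open import Data.Bool using (Bool; true; false; if_then_else_; _∧_; _∨_; not)
open import Data.Fin using (zero; suc; _≟_)
open import Data.Product using (_,_)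
open import Data.Sum using (inj₁; inj₂)
open import Data.Unit using (tt)
open import Relation.Nullary.Decidable using (⌊_⌋; yes; no)
open import Relation.Binary.PropositionalEquality
open import Algebra.Properties.CommutativeSemiring.Exp +-*-commutativeSemiring using (^-distrib-*)
import Algebra.Properties.CommutativeSemigroup +-commutativeSemigroup as +-CS
import Algebra.Properties.CommutativeSemigroup *-commutativeSemigroup as *-CS

-- Write k = ℓ^0.1, so ℓ = k^10 and ℓ' = k^9 − k^6; (i) and (iii) follow from
-- k^10 < k p' + k^7 and d' < p'.  In an earlier bin, k p' ≥ p + k^8 gives both
-- directly (k d' ≤ d + k^7 < p + k^8).  In the last bin every neighbour in an
-- earlier bin removes at most one colour and is not counted in d', so
-- p + d' ≤ p' + d; with d < p this gives d' < p', and with d ≤ k d' + k^7 it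
-- gives k p' + k^7 ≥ p + (k − 1)(p − d) > k^10.  For (ii), k d' ≤ d + k^7
-- gives d' ≤ t^3 + 2t^2 with t = k^3, so d' − ℓ' ≤ 3t^2, and
-- (3t^2)^10 ≤ (t^3 − t^2)^7 as soon as t ≥ 4^7 · 27.

⟦_⟧ : Bool → ℕ
⟦ b ⟧ = if b then 1 else 0

countF-cong : ∀ {m} {f g : Fin m → Bool} → (∀ i → f i ≡ g i) → countF f ≡ countF g
countF-cong {zero}  f≗g = refl
countF-cong {suc m} f≗g = cong₂ (λ b c → ⟦ b ⟧ + c) (f≗g zero) (countF-cong (λ i → f≗g (suc i)))

countF-false : ∀ m → countF {m} (λ _ → false) ≡ 0
countF-false zero    = refl
countF-false (suc m) = countF-false m

countF-≟ : ∀ {m} (c : Fin m) → countF (λ γ → ⌊ c ≟ γ ⌋) ≡ 1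
countF-≟ {suc m} zero    = cong suc (countF-false m)
countF-≟ {suc m} (suc c) = trans (countF-cong (⌊suc≟suc⌋ c)) (countF-≟ c)
  where
  ⌊suc≟suc⌋ : ∀ {m} (c i : Fin m) → ⌊ suc c ≟ suc i ⌋ ≡ ⌊ c ≟ i ⌋
  ⌊suc≟suc⌋ c i with c ≟ i
  ... | yes _ = refl
  ... | no  _ = refl

countF-≤-+ : ∀ {m} {f g h : Fin m → Bool} → (∀ i → ⟦ h i ⟧ ≤ ⟦ f i ⟧ + ⟦ g i ⟧) →
             countF h ≤ countF f + countF g
countF-≤-+ {zero}          h≤f+g = z≤n
countF-≤-+ {suc m} {f} {g} h≤f+g =
  ≤-trans (+-mono-≤ (h≤f+g zero) (countF-≤-+ (λ i → h≤f+g (suc i))))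
          (≤-reflexive (+-CS.interchange ⟦ f zero ⟧ ⟦ g zero ⟧ (countF (λ i → f (suc i))) (countF (λ i → g (suc i)))))

countF-+-≤ : ∀ {m} {f g h : Fin m → Bool} → (∀ i → ⟦ f i ⟧ + ⟦ g i ⟧ ≤ ⟦ h i ⟧) →
             countF f + countF g ≤ countF h
countF-+-≤ {zero}          f+g≤h = z≤n
countF-+-≤ {suc m} {f} {g} f+g≤h =
  ≤-trans (≤-reflexive (+-CS.interchange ⟦ f zero ⟧ (countF (λ i → f (suc i))) ⟦ g zero ⟧ (countF (λ i → g (suc i)))))
          (+-mono-≤ (f+g≤h zero) (countF-+-≤ (λ i → f+g≤h (suc i))))

⟦∨⟧≤⟦⟧+⟦⟧ : ∀ a b → ⟦ a ∨ b ⟧ ≤ ⟦ a ⟧ + ⟦ b ⟧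
⟦∨⟧≤⟦⟧+⟦⟧ true  b = s≤s z≤n
⟦∨⟧≤⟦⟧+⟦⟧ false b = ≤-refl

countF-anyF-≤ : ∀ {N C} (e : Fin N → Fin C → Bool) (s : Fin N → Bool) →
                (∀ u → countF (e u) ≤ ⟦ s u ⟧) →
                countF (λ γ → anyF (λ u → e u γ)) ≤ countF s
countF-anyF-≤ {zero}  {C} e s e≤s = ≤-reflexive (countF-false C)
countF-anyF-≤ {suc N}     e s e≤s = ≤-trans
  (countF-≤-+ (λ γ → ⟦∨⟧≤⟦⟧+⟦⟧ (e zero γ) (anyF (λ u → e (suc u) γ))))
  (+-mono-≤ (e≤s zero) (countF-anyF-≤ (λ u → e (suc u)) (λ u → s (suc u)) (λ u → e≤s (suc u))))

3t²^10≤x^7 : ∀ t x → 4 ^ 7 * 27 ≤ t → 3 * t ^ 3 ≤ 4 * x → (3 * t ^ 2) ^ 10 ≤ x ^ 7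
3t²^10≤x^7 t x t-large 3t³≤4x = *-cancelˡ-≤ (4 ^ 7) (begin
  4 ^ 7 * a ^ 10                 ≡⟨ cong (4 ^ 7 *_) (^-distribˡ-+-* a 7 3) ⟩
  4 ^ 7 * (a ^ 7 * a ^ 3)        ≡⟨ *-CS.x∙yz≈y∙xz (4 ^ 7) (a ^ 7) (a ^ 3) ⟩
  a ^ 7 * (4 ^ 7 * a ^ 3)        ≡⟨ cong (λ z → a ^ 7 * (4 ^ 7 * z)) a³≡27t⁶ ⟩
  a ^ 7 * (4 ^ 7 * (27 * t ^ 6)) ≡⟨ cong (a ^ 7 *_) (*-assoc (4 ^ 7) 27 (t ^ 6)) ⟨
  a ^ 7 * (4 ^ 7 * 27 * t ^ 6)   ≤⟨ *-monoʳ-≤ (a ^ 7) (*-monoˡ-≤ (t ^ 6) t-large) ⟩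
  a ^ 7 * t ^ 7                  ≡⟨ ^-distrib-* a t 7 ⟨
  (a * t) ^ 7                    ≡⟨ cong (_^ 7) at≡3t³ ⟩
  (3 * t ^ 3) ^ 7                ≤⟨ ^-monoˡ-≤ 7 3t³≤4x ⟩
  (4 * x) ^ 7                    ≡⟨ ^-distrib-* 4 x 7 ⟩
  4 ^ 7 * x ^ 7                  ∎)
  where
  open ≤-Reasoning
  a : ℕ
  a = 3 * t ^ 2
  a³≡27t⁶ : a ^ 3 ≡ 27 * t ^ 6
  a³≡27t⁶ = trans (^-distrib-* 3 (t ^ 2) 3) (cong (27 *_) (^-*-assoc t 2 3))
  at≡3t³ : a * t ≡ 3 * t ^ 3
  at≡3t³ = trans (*-assoc 3 (t ^ 2) t) (cong (3 *_) (*-comm (t ^ 2) t))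

3t³≤4[t³∸t²] : ∀ t → 4 ≤ t → 3 * t ^ 3 ≤ 4 * (t ^ 3 ∸ t ^ 2)
3t³≤4[t³∸t²] t 4≤t = subst (3 * t ^ 3 ≤_) (sym (*-distribˡ-∸ 4 (t ^ 3) (t ^ 2)))
  (m+n≤o⇒m≤o∸n (3 * t ^ 3) (begin
    3 * t ^ 3 + 4 * t ^ 2 ≤⟨ +-monoʳ-≤ (3 * t ^ 3) (*-monoˡ-≤ (t ^ 2) 4≤t) ⟩
    3 * t ^ 3 + t ^ 3     ≡⟨ +-comm (3 * t ^ 3) (t ^ 3) ⟩
    4 * t ^ 3             ∎))
  where open ≤-Reasoning

∸[t³∸t²]≤3t² : ∀ t d → t ^ 2 ≤ t ^ 3 → d ≤ t ^ 3 + 2 * t ^ 2 → d ∸ (t ^ 3 ∸ t ^ 2) ≤ 3 * t ^ 2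
∸[t³∸t²]≤3t² t d t²≤t³ d≤ = m≤n+o⇒m∸n≤o d (t ^ 3 ∸ t ^ 2) (begin
  d                                   ≤⟨ d≤ ⟩
  t ^ 3 + 2 * t ^ 2                   ≡⟨ cong (_+ 2 * t ^ 2) (m∸n+n≡m t²≤t³) ⟨
  (t ^ 3 ∸ t ^ 2) + t ^ 2 + 2 * t ^ 2 ≡⟨ +-assoc (t ^ 3 ∸ t ^ 2) (t ^ 2) (2 * t ^ 2) ⟩
  (t ^ 3 ∸ t ^ 2) + 3 * t ^ 2         ∎)
  where open ≤-Reasoning

[d∸[t³∸t²]]^10≤[t³∸t²]^7 : ∀ t d → 4 ^ 7 * 27 ≤ t → d ≤ t ^ 3 + 2 * t ^ 2 →
                          (d ∸ (t ^ 3 ∸ t ^ 2)) ^ 10 ≤ (t ^ 3 ∸ t ^ 2) ^ 7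
[d∸[t³∸t²]]^10≤[t³∸t²]^7 t@(suc _) d t-large d≤ = ≤-trans
  (^-monoˡ-≤ 10 (∸[t³∸t²]≤3t² t d (m≤n*m (t ^ 2) t) d≤))
  (3t²^10≤x^7 t (t ^ 3 ∸ t ^ 2) t-large (3t³≤4[t³∸t²] t (≤-trans (≤ᵇ⇒≤ 4 (4 ^ 7 * 27) tt) t-large)))

deg'-excess : ∀ k d d' → 100 ≤ k → k * d' ≤ d + k ^ 7 → d ≤ k ^ 10 + k ^ 7 →
              (d' ∸ (k ^ 9 ∸ k ^ 6)) ^ 10 ≤ (k ^ 9 ∸ k ^ 6) ^ 7
deg'-excess k d d' 100≤k kd'≤ d≤ =
  subst₂ (λ a b → (d' ∸ (a ∸ b)) ^ 10 ≤ (a ∸ b) ^ 7) (^-*-assoc k 3 3) (^-*-assoc k 3 2)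
    ([d∸[t³∸t²]]^10≤[t³∸t²]^7 (k ^ 3) d' k³-large
      (subst₂ (λ a b → d' ≤ a + 2 * b) (sym (^-*-assoc k 3 3)) (sym (^-*-assoc k 3 2)) d'≤))
  where
  k³-large : 4 ^ 7 * 27 ≤ k ^ 3
  k³-large = ≤-trans (≤ᵇ⇒≤ (4 ^ 7 * 27) (100 ^ 3) tt) (^-monoˡ-≤ 3 100≤k)
  factor : ∀ k a b → k * a + k * b + k * b ≡ k * (a + 2 * b)
  factor = solve-∀
  d'≤ : d' ≤ k ^ 9 + 2 * k ^ 6
  d'≤ = *-cancelˡ-≤ k {{>-nonZero (≤-trans (s≤s z≤n) 100≤k)}} (begin
    k * d'                  ≤⟨ kd'≤ ⟩
    d + k ^ 7               ≤⟨ +-monoˡ-≤ (k ^ 7) d≤ ⟩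
    k ^ 10 + k ^ 7 + k ^ 7  ≡⟨ factor k (k ^ 9) (k ^ 6) ⟩
    k * (k ^ 9 + 2 * k ^ 6) ∎)
    where open ≤-Reasoning

k⁹∸k⁶<p : ∀ k p .{{_ : NonZero k}} → k ^ 10 < k * p + k ^ 7 → k ^ 9 ∸ k ^ 6 < p
k⁹∸k⁶<p k p k¹⁰< = subst (k ^ 9 ∸ k ^ 6 <_) (m+n∸n≡m p (k ^ 6))
  (∸-monoˡ-< k⁹<p+k⁶ (^-monoʳ-≤ k (≤ᵇ⇒≤ 6 9 tt)))
  where
  k⁹<p+k⁶ : k ^ 9 < p + k ^ 6
  k⁹<p+k⁶ = *-cancelˡ-< k (k ^ 9) (p + k ^ 6) (subst (k ^ 10 <_) (sym (*-distribˡ-+ k p (k ^ 6))) k¹⁰<)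

earlier-bin-bounds : ∀ k {d d' p p'} .{{_ : NonZero k}} →
  k * d' ≤ d + k ^ 7 → p + k ^ 8 ≤ k * p' → k ^ 10 < p → d < p →
  (k ^ 10 < k * p' + k ^ 7) × (d' < p')
earlier-bin-bounds k {d} {d'} {p} {p'} kd'≤ p+k⁸≤ k¹⁰<p d<p =
  ≤-trans k¹⁰<p (≤-trans (m≤m+n p (k ^ 8)) (≤-trans p+k⁸≤ (m≤m+n (k * p') (k ^ 7)))) ,
  *-cancelˡ-< k d' p' (begin-strict
    k * d'    ≤⟨ kd'≤ ⟩
    d + k ^ 7 <⟨ +-monoˡ-< (k ^ 7) d<p ⟩
    p + k ^ 7 ≤⟨ +-monoʳ-≤ p (m≤n*m (k ^ 7) k) ⟩
    p + k ^ 8 ≤⟨ p+k⁸≤ ⟩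
    k * p'    ∎)
  where open ≤-Reasoning

p+kd≤kp+d : ∀ k {p d} .{{_ : NonZero k}} → d ≤ p → p + k * d ≤ k * p + d
p+kd≤kp+d k@(suc j) {p} {d} d≤p = begin
  p + (d + j * d) ≡⟨ +-CS.x∙yz≈y∙xz p d (j * d) ⟩
  d + (p + j * d) ≤⟨ +-monoʳ-≤ d (+-monoʳ-≤ p (*-monoʳ-≤ j d≤p)) ⟩
  d + (p + j * p) ≡⟨ +-comm d (k * p) ⟩
  k * p + d       ∎
  where open ≤-Reasoning

last-bin-bounds : ∀ k {d d' p p'} .{{_ : NonZero k}} →
  d ≤ k * d' + k ^ 7 → p + d' ≤ p' + d → k ^ 10 < p → d < p →
  (k ^ 10 < k * p' + k ^ 7) × (d' < p')
last-bin-bounds k {d} {d'} {p} {p'} d≤ p+d'≤ k¹⁰<p d<p =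
  +-cancelʳ-< (k * d) (k ^ 10) (k * p' + k ^ 7) (begin-strict
    k ^ 10 + k * d           <⟨ +-monoˡ-< (k * d) k¹⁰<p ⟩
    p + k * d                ≤⟨ p+kd≤kp+d k (<⇒≤ d<p) ⟩
    k * p + d                ≤⟨ +-monoʳ-≤ (k * p) d≤ ⟩
    k * p + (k * d' + k ^ 7) ≡⟨ +-assoc (k * p) (k * d') (k ^ 7) ⟨
    k * p + k * d' + k ^ 7   ≡⟨ cong (_+ k ^ 7) (*-distribˡ-+ k p d') ⟨
    k * (p + d') + k ^ 7     ≤⟨ +-monoˡ-≤ (k ^ 7) (*-monoʳ-≤ k p+d'≤) ⟩
    k * (p' + d) + k ^ 7     ≡⟨ cong (_+ k ^ 7) (*-distribˡ-+ k p' d) ⟩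
    k * p' + k * d + k ^ 7   ≡⟨ +-CS.xy∙z≈xz∙y (k * p') (k * d) (k ^ 7) ⟩
    k * p' + k ^ 7 + k * d   ∎) ,
  +-cancelʳ-< d d' p' (begin-strict
    d' + d <⟨ +-monoʳ-< d' d<p ⟩
    d' + p ≡⟨ +-comm d' p ⟩
    p + d' ≤⟨ p+d'≤ ⟩
    p' + d ∎)
  where open ≤-Reasoning

degBelow : (G : PaletteGraph) → ℕ → (Fin (n G) → ℕ) → Fin (n G) → ℕ
degBelow G k h1 v = countF (λ u → adj G v u ∧ (h1 u <ᵇ k))

n<ᵇn≡false : ∀ n → (n <ᵇ n) ≡ false
n<ᵇn≡false zero    = refl
n<ᵇn≡false (suc n) = n<ᵇn≡false n

⟦<ᵇ⟧+⟦≡ᵇ⟧≤1 : ∀ m n → ⟦ m <ᵇ n ⟧ + ⟦ m ≡ᵇ n ⟧ ≤ 1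
⟦<ᵇ⟧+⟦≡ᵇ⟧≤1 zero    zero    = ≤-refl
⟦<ᵇ⟧+⟦≡ᵇ⟧≤1 zero    (suc n) = ≤-refl
⟦<ᵇ⟧+⟦≡ᵇ⟧≤1 (suc m) zero    = z≤n
⟦<ᵇ⟧+⟦≡ᵇ⟧≤1 (suc m) (suc n) = ⟦<ᵇ⟧+⟦≡ᵇ⟧≤1 m n

⟦⟧≤⟦∧not⟧+⟦⟧ : ∀ b a → ⟦ b ⟧ ≤ ⟦ b ∧ not a ⟧ + ⟦ a ⟧
⟦⟧≤⟦∧not⟧+⟦⟧ true  true  = ≤-refl
⟦⟧≤⟦∧not⟧+⟦⟧ true  false = ≤-refl
⟦⟧≤⟦∧not⟧+⟦⟧ false a     = z≤n

countF-∧-∧-≟-≤ : ∀ {m} a b (c : Fin m) → countF (λ γ → a ∧ b ∧ ⌊ c ≟ γ ⌋) ≤ ⟦ a ∧ b ⟧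
countF-∧-∧-≟-≤     true  true  c = ≤-reflexive (countF-≟ c)
countF-∧-∧-≟-≤ {m} true  false c = ≤-reflexive (countF-false m)
countF-∧-∧-≟-≤ {m} false b     c = ≤-reflexive (countF-false m)

pal≤pal'+degBelow : ∀ G k h1 h2 col v → h1 v ≡ k →
                    pal G v ≤ pal' G k h1 h2 col v + degBelow G k h1 v
pal≤pal'+degBelow G k h1 h2 col v h1v≡k = begin
  pal G v                                  ≤⟨ countF-≤-+ (λ γ → ⟦⟧≤⟦∧not⟧+⟦⟧ (palette G v γ) (used γ)) ⟩
  countF avail + countF used               ≤⟨ +-monoʳ-≤ (countF avail) (countF-anyF-≤ usedBy below usedBy≤1) ⟩
  countF avail + degBelow G k h1 v         ≡⟨ cong (_+ degBelow G k h1 v) pal'≡ ⟨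
  pal' G k h1 h2 col v + degBelow G k h1 v ∎
  where
  open ≤-Reasoning
  below : Fin (n G) → Bool
  below u = adj G v u ∧ (h1 u <ᵇ k)
  usedBy : Fin (n G) → Fin (C G) → Bool
  usedBy u γ = adj G v u ∧ (h1 u <ᵇ k) ∧ ⌊ col u ≟ γ ⌋
  used : Fin (C G) → Bool
  used γ = anyF (λ u → usedBy u γ)
  avail : Fin (C G) → Bool
  avail γ = palette G v γ ∧ not (used γ)
  usedBy≤1 : ∀ u → countF (usedBy u) ≤ ⟦ below u ⟧
  usedBy≤1 u = countF-∧-∧-≟-≤ (adj G v u) (h1 u <ᵇ k) (col u)
  pal'≡ : pal' G k h1 h2 col v ≡ countF avail
  pal'≡ = cong (λ b → if b then countF (λ γ → palette G v γ ∧ (h2 γ ≡ᵇ h1 v)) else countF avail)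
               (trans (cong (h1 v <ᵇ_) (sym h1v≡k)) (n<ᵇn≡false (h1 v)))

degBelow+deg'≤deg : ∀ G k h1 v → h1 v ≡ k → degBelow G k h1 v + deg' G h1 v ≤ deg G v
degBelow+deg'≤deg G _ h1 v refl = countF-+-≤ (λ u → below-or-same (adj G v u) (h1 u))
  where
  below-or-same : ∀ a m → ⟦ a ∧ (m <ᵇ h1 v) ⟧ + ⟦ a ∧ (m ≡ᵇ h1 v) ⟧ ≤ ⟦ a ⟧
  below-or-same true  m = ⟦<ᵇ⟧+⟦≡ᵇ⟧≤1 m (h1 v)
  below-or-same false m = z≤n

pal+deg'≤pal'+deg : ∀ G k h1 h2 col v → h1 v ≡ k →
                    pal G v + deg' G h1 v ≤ pal' G k h1 h2 col v + deg G v
pal+deg'≤pal'+deg G k h1 h2 col v h1v≡k = begin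
  pal G v + d'         ≤⟨ +-monoˡ-≤ d' (pal≤pal'+degBelow G k h1 h2 col v h1v≡k) ⟩
  p' + below + d'      ≡⟨ +-assoc p' below d' ⟩
  p' + (below + d')    ≤⟨ +-monoʳ-≤ p' (degBelow+deg'≤deg G k h1 v h1v≡k) ⟩
  p' + deg G v         ∎
  where
  open ≤-Reasoning
  p' d' below : ℕ
  p' = pal' G k h1 h2 col v
  d' = deg' G h1 v
  below = degBelow G k h1 v

good⇒k*deg'≤deg+k⁷ : ∀ G k h1 h2 col v → Good G k h1 h2 col v → k * deg' G h1 v ≤ deg G v + k ^ 7
good⇒k*deg'≤deg+k⁷ G k h1 h2 col v (inj₁ (_ , (le , _) , _)) = le
good⇒k*deg'≤deg+k⁷ G k h1 h2 col v (inj₂ (_ , (le , _)))     = le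

good⇒pal'-bounds : ∀ k .{{_ : NonZero k}} G h1 h2 col v →
  k ^ 10 < pal G v → deg G v < pal G v → Good G k h1 h2 col v →
  (k ^ 10 < k * pal' G k h1 h2 col v + k ^ 7) × (deg' G h1 v < pal' G k h1 h2 col v)
good⇒pal'-bounds k G h1 h2 col v k¹⁰<p d<p (inj₁ (_ , (kd'≤ , _) , p+k⁸≤)) =
  earlier-bin-bounds k kd'≤ p+k⁸≤ k¹⁰<p d<p
good⇒pal'-bounds k G h1 h2 col v k¹⁰<p d<p (inj₂ (h1v≡k , (_ , d≤))) =
  last-bin-bounds k d≤ (pal+deg'≤pal'+deg G k h1 h2 col v h1v≡k) k¹⁰<p d<p

lemma3p2 : Σ ℕ λ K → (k : ℕ) → K ≤ k →
    (G : PaletteGraph) (h1 : Fin (n G) → ℕ) (h2 : Fin (C G) → ℕ)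
    (col : Fin (n G) → Fin (C G)) →
    (∀ v → 1 ≤ h1 v × h1 v ≤ k) →
    (∀ γ → 1 ≤ h2 γ × h2 γ < k) →
    (∀ v → k ^ 10 < pal G v) →
    (∀ v → deg G v ≤ k ^ 10 + k ^ 7) →
    (∀ v → deg G v < pal G v) →
    ∀ v → Good G k h1 h2 col v →
      (k ^ 9 ∸ k ^ 6 < pal' G k h1 h2 col v)
      × ((deg' G h1 v ∸ (k ^ 9 ∸ k ^ 6)) ^ 10 ≤ (k ^ 9 ∸ k ^ 6) ^ 7)
      × (deg' G h1 v < pal' G k h1 h2 col v)
lemma3p2 = 100 , λ k 100≤k G h1 h2 col _ _ k¹⁰<pal deg≤ deg<pal v good →
  let k≢0 = >-nonZero (≤-trans (s≤s z≤n) 100≤k)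
      (k¹⁰<kp'+k⁷ , d'<p') = good⇒pal'-bounds k {{k≢0}} G h1 h2 col v (k¹⁰<pal v) (deg<pal v) good
  in  k⁹∸k⁶<p k _ {{k≢0}} k¹⁰<kp'+k⁷ ,
      deg'-excess k _ _ 100≤k (good⇒k*deg'≤deg+k⁷ G k h1 h2 col v good) (deg≤ v) ,
      d'<p'
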